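{- Let $L$ be an ABC-function on a graph $G=(V,E)$. Then for every profile $\pi$, every vertex $x\in V$ and every $x'\in L(\pi,x)$, we have $x'\in L(\pi,x')\subseteq L(\pi,x)$.
   Context: Graphs are undirected, simple and connected; $d$ is the distance, $I(u,v)=\{w:d(u,w)+d(w,v)=d(u,v)\}$. A profile is a finite sequence of vertices (repetitions allowed), $V^*$ the set of profiles, $\pi\rho$ concatenation and $(\pi,x)$ the profile $\pi$ with $x$ appended. A consensus function is a map $L:V^*\to 2^V\setminus\{\emptyset\}$. An ABC-function satisfies: (A) $L$ is invariant under permutations of the profile; (B) $L(u,v)=I(u,v)$ for all $u,v$; (C) if $L(\pi)\cap L(\rho)\neq\emptyset$ then $L(\pi\rho)=L(\pi)\cap L(\rho)$. -}

module Defs where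

open import Data.Nat using (ℕ; zero; suc; _+_; _≤_)
open import Data.Product using (Σ; ∃; ∃-syntax; _×_; _,_)
open import Data.List using (List; []; _∷_; _++_; [_])
open import Data.List.Relation.Binary.Permutation.Propositional using (_↭_)
open import Relation.Nullary using (¬_)
open import Relation.Binary.PropositionalEquality using (_≡_)

Subset : Set → Set₁
Subset V = V → Set

_⊆_ : {V : Set} → Subset V → Subset V → Set
A ⊆ B = ∀ x → A x → B x

_≐_ : {V : Set} → Subset V → Subset V → Set
A ≐ B = (A ⊆ B) × (B ⊆ A)

_∩_ : {V : Set} → Subset V → Subset V → Subset V
(A ∩ B) x = A x × B x

data Walk {V : Set} (E : V → V → Set) : V → V → ℕ → Set where
  here : ∀ {u} → Walk E u u zero
  step : ∀ {u w v k} → E u w → Walk E w v k → Walk E u v (suc k)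

record Graph : Set₁ where
  field
    V         : Set
    E         : V → V → Set
    E-sym     : ∀ {u v} → E u v → E v u
    E-irrefl  : ∀ {u} → ¬ E u u
    connected : ∀ u v → ∃[ k ] Walk E u v k

module _ (G : Graph) where
  open Graph G

  Dist : V → V → ℕ → Set
  Dist u v k = Walk E u v k × (∀ m → Walk E u v m → k ≤ m)

  Interval : V → V → Subset V
  Interval u v w = ∃[ a ] ∃[ b ] ∃[ c ]
    (Dist u w a × Dist w v b × Dist u v c × (a + b ≡ c))

  Profile : Set
  Profile = List V

  _,ᵖ_ : Profile → V → Profile
  π ,ᵖ x = π ++ [ x ]

  record ConsensusFunction : Set₁ where
    field
      L        : Profile → Subset V
      nonempty : ∀ π → ∃[ x ] L π x

  record IsABC (C : ConsensusFunction) : Set where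
    open ConsensusFunction C
    field
      A-anon : ∀ π ρ → π ↭ ρ → L π ≐ L ρ
      B-betw : ∀ u v → L (u ∷ v ∷ []) ≐ Interval u v
      C-cons : ∀ π ρ → (∃[ x ] (L π ∩ L ρ) x) → L (π ++ ρ) ≐ (L π ∩ L ρ)

{-# OPTIONS --safe #-}
module Submission where

-- Let y ∈ L(π,x'). Both x' and y lie in the intervals I(x',y) and I(x,y), so
-- consistency gives L(π,x,x',y) = L(π,x) ∩ I(x',y) ∋ x' and
-- L(π,x',x,y) = L(π,x') ∩ I(x,y) ∋ y. The two profiles are permutations of
-- each other, so by anonymity both sets coincide and contain x' and y; hence
-- x' ∈ L(π,x') and y ∈ L(π,x).

open import Defs
open import Data.Product using (∃-syntax; _×_; _,_; proj₁; proj₂)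
open import Data.Nat using (z≤n)
open import Data.Nat.Properties using (+-identityʳ)
open import Data.List using (List; []; _∷_; _++_; [_])
open import Data.List.Properties using (++-assoc)
open import Data.List.Relation.Binary.Permutation.Propositional
  using (_↭_; swap; ↭-refl; module PermutationReasoning)
open import Data.List.Relation.Binary.Permutation.Propositional.Properties using (++⁺ˡ)
open import Relation.Binary.PropositionalEquality using (refl)

++-[]-swap : {A : Set} (π : List A) (a b : A) (ρ : List A) →
  (π ++ [ a ]) ++ (b ∷ ρ) ↭ (π ++ [ b ]) ++ (a ∷ ρ)
++-[]-swap π a b ρ = begin
  (π ++ [ a ]) ++ (b ∷ ρ)  ≡⟨ ++-assoc π [ a ] (b ∷ ρ) ⟩
  π ++ (a ∷ b ∷ ρ)         ↭⟨ ++⁺ˡ π (swap a b ↭-refl) ⟩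
  π ++ (b ∷ a ∷ ρ)         ≡⟨ ++-assoc π [ b ] (a ∷ ρ) ⟨
  (π ++ [ b ]) ++ (a ∷ ρ)  ∎
  where open PermutationReasoning

module _ (G : Graph) where
  open Graph G

  Dist-refl : ∀ u → Dist G u u 0
  Dist-refl u = here , λ _ _ → z≤n

  source∈Interval : ∀ {u v c} → Dist G u v c → Interval G u v u
  source∈Interval {u} {c = c} d = 0 , c , c , Dist-refl u , d , d , refl

  target∈Interval : ∀ {u v c} → Dist G u v c → Interval G u v v
  target∈Interval {v = v} {c} d = c , 0 , c , d , Dist-refl v , d , +-identityʳ c

module _ (G : Graph) (C : ConsensusFunction G) (abc : IsABC G C) where
  open Graph G
  open ConsensusFunction C
  open IsABC abc

  -- Distances exist because L(u,v) = I(u,v) is nonempty.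
  Dist-exists : ∀ u v → ∃[ c ] Dist G u v c
  Dist-exists u v with proj₁ (B-betw u v) _ (proj₂ (nonempty (u ∷ v ∷ [])))
  ... | _ , _ , c , _ , _ , d , _ = c , d

  source∈L : ∀ u v → L (u ∷ v ∷ []) u
  source∈L u v = proj₂ (B-betw u v) u (source∈Interval G (proj₂ (Dist-exists u v)))

  target∈L : ∀ u v → L (u ∷ v ∷ []) v
  target∈L u v = proj₂ (B-betw u v) v (target∈Interval G (proj₂ (Dist-exists u v)))

  exchange : ∀ π x x' y → L (π ++ [ x ]) x' → L (π ++ [ x' ]) y →
    L (π ++ [ x' ]) x' × L (π ++ [ x ]) y
  exchange π x x' y x'∈Lπx y∈Lπx' =
    proj₁ (proj₁ via-x' x' x'∈Lπx'xy) , proj₁ (proj₁ via-x y y∈Lπxx'y)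
    where
    via-x : L ((π ++ [ x ]) ++ (x' ∷ y ∷ [])) ≐ (L (π ++ [ x ]) ∩ L (x' ∷ y ∷ []))
    via-x = C-cons _ _ (x' , x'∈Lπx , source∈L x' y)

    via-x' : L ((π ++ [ x' ]) ++ (x ∷ y ∷ [])) ≐ (L (π ++ [ x' ]) ∩ L (x ∷ y ∷ []))
    via-x' = C-cons _ _ (y , y∈Lπx' , target∈L x y)

    reorder : L ((π ++ [ x ]) ++ (x' ∷ y ∷ [])) ≐ L ((π ++ [ x' ]) ++ (x ∷ y ∷ []))
    reorder = A-anon _ _ (++-[]-swap π x x' (y ∷ []))

    x'∈Lπx'xy : L ((π ++ [ x' ]) ++ (x ∷ y ∷ [])) x'
    x'∈Lπx'xy = proj₁ reorder x' (proj₂ via-x x' (x'∈Lπx , source∈L x' y))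

    y∈Lπxx'y : L ((π ++ [ x ]) ++ (x' ∷ y ∷ [])) y
    y∈Lπxx'y = proj₂ reorder y (proj₂ via-x' y (y∈Lπx' , target∈L x y))

lemma2 : (G : Graph) (C : ConsensusFunction G) → IsABC G C →
    ∀ (π : Profile G) (x x' : Graph.V G) →
    ConsensusFunction.L C (_,ᵖ_ G π x) x' →
    ConsensusFunction.L C (_,ᵖ_ G π x') x' ×
      (ConsensusFunction.L C (_,ᵖ_ G π x') ⊆ ConsensusFunction.L C (_,ᵖ_ G π x))
lemma2 G C abc π x x' x'∈Lπx =
  proj₁ (exchange G C abc π x x' y x'∈Lπx y∈Lπx') ,
  λ z z∈Lπx' → proj₂ (exchange G C abc π x x' z x'∈Lπx z∈Lπx')
  where
  open ConsensusFunction C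
  y : Graph.V G
  y = proj₁ (nonempty (_,ᵖ_ G π x'))

  y∈Lπx' : L (_,ᵖ_ G π x') y
  y∈Lπx' = proj₂ (nonempty (_,ᵖ_ G π x'))
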